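{- Let $p$ be a prime and $\alpha$ a positive integer. Then for any integer $1\leq k\leq p^\alpha(p-1)$, $$ s(p^\alpha(p-1),k)\equiv\begin{cases} 1\pmod{p}&\text{if }k\equiv 0\pmod{p^{\alpha-1}(p-1)},\\ 0\pmod{p}&\text{otherwise}. \end{cases} $$
   Context: The (unsigned) Stirling numbers of the first kind $s(n,k)$ are defined by $x(x+1)\cdots(x+n-1)=\sum_{k=0}^n s(n,k)x^k$. -}

module Defs where

open import Data.Nat using (ℕ; zero; suc; _+_; _*_)

-- A polynomial with ℕ coefficients, represented by its coefficient function:
-- (P k) is the coefficient of x^k.
Poly : Set
Poly = ℕ → ℕ

mulLinear : ℕ → Poly → Poly
mulLinear m P zero    = m * P zero
mulLinear m P (suc k) = P k + m * P (suc k)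

one : Poly
one zero    = 1
one (suc k) = 0

risingFact : ℕ → Poly
risingFact zero    = one
risingFact (suc n) = mulLinear n (risingFact n)

-- unsigned Stirling numbers of the first kind:
-- x(x+1)...(x+n-1) = Σ_k s(n,k) x^k
stirling1 : ℕ → ℕ → ℕ
stirling1 n k = risingFact n k

open import Data.Product using (∃₂)
open import Relation.Binary.PropositionalEquality using (_≡_)

_≡_[mod_] : ℕ → ℕ → ℕ → Set
a ≡ b [mod m ] = ∃₂ λ x y → a + x * m ≡ b + y * m

{-# OPTIONS --safe #-}
module Submission where

-- Work modulo p with R n = x(x+1)⋯(x+n-1) = Σ s(n,k) x^k.
-- (1) R p ≡ x^p - x: the difference has degree < p, no constant term, and is invariant
--     under x ↦ x + 1, because x·R p (x+1) = R (p+1) = R p · (x+p) ≡ R p · x; such a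
--     polynomial vanishes, by downward induction on its coefficients.
-- (2) If p ∣ c then x + (c·t + i) ≡ x + i, so R (c·j) ≡ (R c)^j.
-- (3) From (1), (2) and Frobenius, (x^w - 1)^p ≡ x^(p·w) - 1, induction on a gives
--     R (p^(a+1)) ≡ x^(p^a)·(x^M - 1) with M = p^a(p-1).
-- (4) Hence R (p^(a+1)(p-1)) ≡ x^M (x^M - 1)^(p-1) ≡ x^M (1 + x^M + ⋯ + x^((p-1)M)): the
--     coefficients of (y - 1)^(p-1) are all ≡ 1, because the inner coefficients of
--     (y - 1)^p ≡ y^p - 1 are differences of consecutive ones.

open import Defs
open import Data.Integer.Base using (ℤ; +_; -[1+_]; 0ℤ; 1ℤ; -1ℤ; ∣_∣)
open import Data.Nat.Base using (ℕ; zero; suc; _<_; _≤_; z≤n; s≤s; z<s)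
import Data.Nat.Base as ℕ
import Data.Nat.Properties as ℕ
open import Data.Product.Base using (_×_; _,_; ∃-syntax)
open import Data.Sum.Base using (inj₁; inj₂)
open import Data.Nat.Primality using (Prime; euclidsLemma; prime⇒nonTrivial; ¬prime[0]; ¬prime[1])
open import Data.Empty using (⊥-elim)
open import Function.Base using (const; _∘_)
open import Data.Nat.GeneralisedArithmetic using (fold)
open import Relation.Binary.Bundles using (Setoid)
import Relation.Binary.Reasoning.Setoid as SetoidReasoning
open import Relation.Binary.Definitions using (tri<; tri≈; tri>)
open import Relation.Binary.PropositionalEquality
open import Relation.Nullary using (¬_; yes; no)

module Congruence (m : ℤ) where
  open import Data.Integer.Base using (_+_; _*_; -_; _-_)
  import Data.Integer.Properties as ℤ
  open import Data.Integer.Tactic.RingSolver using (solve-∀)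

  infix 4 _≈_
  infix 1 _by_
  record _≈_ (x y : ℤ) : Set where
    constructor _by_
    field
      quotient : ℤ
      equation : x ≡ y + quotient * m

  ≈-reflexive : ∀ {x y} → x ≡ y → x ≈ y
  ≈-reflexive {x} refl = 0ℤ by sym (trans (cong (_+_ x) (ℤ.*-zeroˡ m)) (ℤ.+-identityʳ x))

  ≈-refl : ∀ {x} → x ≈ x
  ≈-refl = ≈-reflexive refl

  ≈-sym : ∀ {x y} → x ≈ y → y ≈ x
  ≈-sym {y = y} (q by refl) = - q by cancel y q m
    where
      cancel : ∀ y q m → y ≡ (y + q * m) + (- q) * m
      cancel = solve-∀

  ≈-trans : ∀ {x y z} → x ≈ y → y ≈ z → x ≈ z
  ≈-trans {z = z} (q by refl) (r by refl) = r + q by collect z r q m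
    where
      collect : ∀ z r q m → (z + r * m) + q * m ≡ z + (r + q) * m
      collect = solve-∀

  ≈-setoid : Setoid _ _
  ≈-setoid = record
    { Carrier = ℤ ; _≈_ = _≈_
    ; isEquivalence = record { refl = ≈-refl ; sym = ≈-sym ; trans = ≈-trans } }

  module ≈-Reasoning = SetoidReasoning ≈-setoid

  +-cong : ∀ {x x′ y y′} → x ≈ x′ → y ≈ y′ → x + y ≈ x′ + y′
  +-cong {x′ = x′} {y′ = y′} (q by refl) (r by refl) = q + r by collect x′ y′ q r m
    where
      collect : ∀ x y q r m → (x + q * m) + (y + r * m) ≡ (x + y) + (q + r) * m
      collect = solve-∀

  *-cong : ∀ {x x′ y y′} → x ≈ x′ → y ≈ y′ → x * y ≈ x′ * y′
  *-cong {x′ = x′} {y′ = y′} (q by refl) (r by refl) =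
    q * y′ + x′ * r + q * r * m by expand x′ y′ q r m
    where
      expand : ∀ x y q r m → (x + q * m) * (y + r * m) ≡ x * y + (q * y + x * r + q * r * m) * m
      expand = solve-∀

  *-congˡ : ∀ c {y y′} → y ≈ y′ → c * y ≈ c * y′
  *-congˡ c = *-cong (≈-refl {c})

  m*x≈0 : ∀ x → m * x ≈ 0ℤ
  m*x≈0 x = x by trans (ℤ.*-comm m x) (sym (ℤ.+-identityˡ (x * m)))

  ≈-stepwise : ∀ (f : ℕ → ℤ) n → (∀ i → i < n → f i ≈ f (suc i)) →
               ∀ {i} → i ≤ n → f i ≈ f n
  ≈-stepwise f zero    step z≤n = ≈-refl
  ≈-stepwise f (suc n) step i≤1+n with ℕ.m≤n⇒m<n∨m≡n i≤1+n
  ... | inj₁ (s≤s i≤n) =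
    ≈-trans (≈-stepwise f n (λ i i<n → step i (ℕ.m<n⇒m<1+n i<n)) i≤n) (step n (ℕ.n<1+n n))
  ... | inj₂ refl = ≈-refl

  +-cancelˡ : ∀ a {x y} → a + x ≈ a + y → x ≈ y
  +-cancelˡ a {x} {y} (q by e) = q by (begin
      x                     ≡⟨ add-sub a x ⟨
      (a + x) - a           ≡⟨ cong (_- a) e ⟩
      (a + y + q * m) - a   ≡⟨ cong (_- a) (ℤ.+-assoc a y (q * m)) ⟩
      (a + (y + q * m)) - a ≡⟨ add-sub a (y + q * m) ⟩
      y + q * m             ∎)
    where
      open ≡-Reasoning
      add-sub : ∀ a x → (a + x) - a ≡ x
      add-sub = solve-∀

module Series where
  open import Data.Integer.Base using (_+_; _*_; _^_)
  import Data.Integer.Properties as ℤ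
  open import Data.Integer.Tactic.RingSolver using (solve-∀)
  open ≡-Reasoning

  -- Polynomials over ℤ, as coefficient sequences: f k is the coefficient of x^k.
  Series : Set
  Series = ℕ → ℤ

  sum : ℕ → (ℕ → ℤ) → ℤ
  sum zero    f = 0ℤ
  sum (suc n) f = f 0 + sum n (λ i → f (suc i))

  sum-cong : ∀ n {f g : ℕ → ℤ} → (∀ i → i < n → f i ≡ g i) → sum n f ≡ sum n g
  sum-cong zero    f≡g = refl
  sum-cong (suc n) f≡g =
    cong₂ _+_ (f≡g 0 (s≤s z≤n)) (sum-cong n (λ i i<n → f≡g (suc i) (s≤s i<n)))

  sum-zero : ∀ n {f : ℕ → ℤ} → (∀ i → i < n → f i ≡ 0ℤ) → sum n f ≡ 0ℤ
  sum-zero n f≡0 = trans (sum-cong n f≡0) (sum-const-zero n)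
    where
      sum-const-zero : ∀ n → sum n (const 0ℤ) ≡ 0ℤ
      sum-const-zero zero    = refl
      sum-const-zero (suc n) = trans (ℤ.+-identityˡ _) (sum-const-zero n)

  sum-distrib-+ : ∀ n (f g : ℕ → ℤ) → sum n (λ i → f i + g i) ≡ sum n f + sum n g
  sum-distrib-+ zero    f g = refl
  sum-distrib-+ (suc n) f g = begin
    (f 0 + g 0) + sum n (λ i → f (suc i) + g (suc i))
      ≡⟨ cong (_+_ (f 0 + g 0)) (sum-distrib-+ n (λ i → f (suc i)) (λ i → g (suc i))) ⟩
    (f 0 + g 0) + (sum n (λ i → f (suc i)) + sum n (λ i → g (suc i)))
      ≡⟨ interchange (f 0) (g 0) _ _ ⟩
    (f 0 + sum n (λ i → f (suc i))) + (g 0 + sum n (λ i → g (suc i))) ∎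
    where
      interchange : ∀ a b c d → (a + b) + (c + d) ≡ (a + c) + (b + d)
      interchange = solve-∀

  *-distribˡ-sum : ∀ n c (f : ℕ → ℤ) → c * sum n f ≡ sum n (λ i → c * f i)
  *-distribˡ-sum zero    c f = ℤ.*-zeroʳ c
  *-distribˡ-sum (suc n) c f =
    trans (ℤ.*-distribˡ-+ c (f 0) _) (cong (_+_ (c * f 0)) (*-distribˡ-sum n c (λ i → f (suc i))))

  sum-last : ∀ n (f : ℕ → ℤ) → sum (suc n) f ≡ sum n f + f n
  sum-last zero    f = trans (ℤ.+-identityʳ (f 0)) (sym (ℤ.+-identityˡ (f 0)))
  sum-last (suc n) f =
    trans (cong (_+_ (f 0)) (sum-last n (λ i → f (suc i)))) (sym (ℤ.+-assoc (f 0) _ _))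

  monomial : ℕ → Series
  monomial zero    zero    = 1ℤ
  monomial zero    (suc k) = 0ℤ
  monomial (suc e) zero    = 0ℤ
  monomial (suc e) (suc k) = monomial e k

  monomial-diag : ∀ e → monomial e e ≡ 1ℤ
  monomial-diag zero    = refl
  monomial-diag (suc e) = monomial-diag e

  monomial-≢ : ∀ {e k} → e ≢ k → monomial e k ≡ 0ℤ
  monomial-≢ {zero}  {zero}  e≢k = ⊥-elim (e≢k refl)
  monomial-≢ {zero}  {suc k} e≢k = refl
  monomial-≢ {suc e} {zero}  e≢k = refl
  monomial-≢ {suc e} {suc k} e≢k = monomial-≢ (e≢k ∘ cong suc)

  sum-select : ∀ n {a} (g : ℕ → ℤ) → a < n → sum n (λ i → monomial a i * g i) ≡ g a
  sum-select (suc n) {zero}  g _ = begin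
    1ℤ * g 0 + sum n (λ i → 0ℤ * g (suc i))
      ≡⟨ cong (_+_ (1ℤ * g 0)) (sum-zero n (λ i _ → ℤ.*-zeroˡ (g (suc i)))) ⟩
    1ℤ * g 0 + 0ℤ
      ≡⟨ trans (ℤ.+-identityʳ _) (ℤ.*-identityˡ (g 0)) ⟩
    g 0 ∎
  sum-select (suc n) {suc a} g (s≤s a<n) = begin
    0ℤ * g 0 + sum n (λ i → monomial a i * g (suc i))
      ≡⟨ cong (_+_ (0ℤ * g 0)) (sum-select n (λ i → g (suc i)) a<n) ⟩
    0ℤ * g 0 + g (suc a)
      ≡⟨ trans (cong (_+ g (suc a)) (ℤ.*-zeroˡ (g 0))) (ℤ.+-identityˡ (g (suc a))) ⟩
    g (suc a) ∎

  sum-select₂ : ∀ n {a b} c (g : ℕ → ℤ) → a < n → b < n →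
                sum n (λ i → (monomial a i + c * monomial b i) * g i) ≡ g a + c * g b
  sum-select₂ n {a} {b} c g a<n b<n = begin
    sum n (λ i → (monomial a i + c * monomial b i) * g i)
      ≡⟨ sum-cong n (λ i _ → expand (monomial a i) c (monomial b i) (g i)) ⟩
    sum n (λ i → monomial a i * g i + c * (monomial b i * g i))
      ≡⟨ sum-distrib-+ n _ _ ⟩
    sum n (λ i → monomial a i * g i) + sum n (λ i → c * (monomial b i * g i))
      ≡⟨ cong₂ _+_ (sum-select n g a<n)
                   (trans (sym (*-distribˡ-sum n c _)) (cong (c *_) (sum-select n g b<n))) ⟩
    g a + c * g b ∎
    where
      expand : ∀ x c y z → (x + c * y) * z ≡ x * z + c * (y * z)
      expand = solve-∀

  sum-monomial-injective : ∀ n (g : ℕ → ℕ) {i k} → (∀ {a b} → g a ≡ g b → a ≡ b) →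
                           i < n → g i ≡ k → sum n (λ j → monomial (g j) k) ≡ 1ℤ
  sum-monomial-injective n g {i} {k} g-injective i<n refl = begin
    sum n (λ j → monomial (g j) (g i)) ≡⟨ sum-cong n (λ j _ → hit j) ⟩
    sum n (λ j → monomial i j * 1ℤ)    ≡⟨ sum-select n (const 1ℤ) i<n ⟩
    1ℤ                                 ∎
    where
      hit : ∀ j → monomial (g j) (g i) ≡ monomial i j * 1ℤ
      hit j with j ℕ.≟ i
      ... | yes refl = trans (monomial-diag (g i)) (sym (cong (_* 1ℤ) (monomial-diag i)))
      ... | no j≢i   =
        trans (monomial-≢ (j≢i ∘ g-injective)) (sym (cong (_* 1ℤ) (monomial-≢ (j≢i ∘ sym))))

  sum-monomial-miss : ∀ n (g : ℕ → ℕ) {k} → (∀ j → j < n → g j ≢ k) →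
                      sum n (λ j → monomial (g j) k) ≡ 0ℤ
  sum-monomial-miss n g miss = sum-zero n (λ j j<n → monomial-≢ (miss j j<n))

  shift : ℕ → Series → Series
  shift zero    f k       = f k
  shift (suc e) f zero    = 0ℤ
  shift (suc e) f (suc k) = shift e f k

  shift-cong : ∀ e {f g : Series} → (∀ k → f k ≡ g k) → ∀ k → shift e f k ≡ shift e g k
  shift-cong zero    f≡g k       = f≡g k
  shift-cong (suc e) f≡g zero    = refl
  shift-cong (suc e) f≡g (suc k) = shift-cong e f≡g k

  shift-shift : ∀ a b f k → shift a (shift b f) k ≡ shift (a ℕ.+ b) f k
  shift-shift zero    b f k       = refl
  shift-shift (suc a) b f zero    = refl
  shift-shift (suc a) b f (suc k) = shift-shift a b f k

  shift-monomial : ∀ e k → shift e (monomial 0) k ≡ monomial e k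
  shift-monomial zero    k       = refl
  shift-monomial (suc e) zero    = refl
  shift-monomial (suc e) (suc k) = shift-monomial e k

  shift-+ : ∀ e (f g : Series) k → shift e (λ k → f k + g k) k ≡ shift e f k + shift e g k
  shift-+ zero    f g k       = refl
  shift-+ (suc e) f g zero    = refl
  shift-+ (suc e) f g (suc k) = shift-+ e f g k

  shift-* : ∀ e c (f : Series) k → shift e (λ k → c * f k) k ≡ c * shift e f k
  shift-* zero    c f k       = refl
  shift-* (suc e) c f zero    = sym (ℤ.*-zeroʳ c)
  shift-* (suc e) c f (suc k) = shift-* e c f k

  shift-sum : ∀ e n (F : ℕ → Series) k →
              shift e (λ k → sum n (λ i → F i k)) k ≡ sum n (λ i → shift e (F i) k)
  shift-sum zero    n F k       = refl
  shift-sum (suc e) n F zero    = sym (sum-zero n (λ _ _ → refl))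
  shift-sum (suc e) n F (suc k) = shift-sum e n F k

  mulFactor : ℕ → ℤ → Series → Series
  mulFactor w c f k = shift w f k + c * f k

  mulFactors : ℕ → (ℕ → ℤ) → ℕ → Series → Series
  mulFactors w cs zero    f = f
  mulFactors w cs (suc n) f = mulFactor w (cs n) (mulFactors w cs n f)

  mulPoly : ℕ → ℕ → Series → Series → Series
  mulPoly w n a f k = sum n (λ i → a i * shift (i ℕ.* w) f k)

  productCoeffs : (ℕ → ℤ) → ℕ → Series
  productCoeffs cs n = mulFactors 1 cs n (monomial 0)

  mulFactor-cong : ∀ w c {f g : Series} → (∀ k → f k ≡ g k) →
                   ∀ k → mulFactor w c f k ≡ mulFactor w c g k
  mulFactor-cong w c f≡g k = cong₂ (λ u v → u + c * v) (shift-cong w f≡g k) (f≡g k)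

  productCoeffs-degree : ∀ cs n {k} → n < k → productCoeffs cs n k ≡ 0ℤ
  productCoeffs-degree cs zero    {suc k} _         = refl
  productCoeffs-degree cs (suc n) {suc k} (s≤s n<k) = begin
    productCoeffs cs n k + cs n * productCoeffs cs n (suc k)
      ≡⟨ cong₂ (λ u v → u + cs n * v) (productCoeffs-degree cs n n<k)
                                       (productCoeffs-degree cs n (ℕ.m<n⇒m<1+n n<k)) ⟩
    0ℤ + cs n * 0ℤ
      ≡⟨ trans (ℤ.+-identityˡ _) (ℤ.*-zeroʳ (cs n)) ⟩
    0ℤ ∎

  productCoeffs-top : ∀ cs n → productCoeffs cs n n ≡ 1ℤ
  productCoeffs-top cs zero    = refl
  productCoeffs-top cs (suc n) = begin
    productCoeffs cs n n + cs n * productCoeffs cs n (suc n)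
      ≡⟨ cong₂ (λ u v → u + cs n * v) (productCoeffs-top cs n)
                                       (productCoeffs-degree cs n (ℕ.n<1+n n)) ⟩
    1ℤ + cs n * 0ℤ
      ≡⟨ cong (_+_ 1ℤ) (ℤ.*-zeroʳ (cs n)) ⟩
    1ℤ ∎

  mulFactor-mulPoly : ∀ w c n (a f : Series) → a n ≡ 0ℤ → ∀ k →
                      mulFactor w c (mulPoly w n a f) k ≡ mulPoly w (suc n) (mulFactor 1 c a) f k
  mulFactor-mulPoly w c n a f aₙ≡0 k = begin
    shift w (mulPoly w n a f) k + c * mulPoly w n a f k
      ≡⟨ cong₂ (λ u v → u + c * v) shifted (sym dropLast) ⟩
    A + c * (a 0 * X 0 + B)
      ≡⟨ regroup A c (a 0) (X 0) B ⟩
    (0ℤ + c * a 0) * X 0 + (A + c * B)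
      ≡⟨ cong (_+_ ((0ℤ + c * a 0) * X 0)) collect ⟩
    (0ℤ + c * a 0) * X 0 + sum n (λ i → (a i + c * a (suc i)) * X (suc i)) ∎
    where
      X : ℕ → ℤ
      X i = shift (i ℕ.* w) f k
      A B : ℤ
      A = sum n (λ i → a i * X (suc i))
      B = sum n (λ i → a (suc i) * X (suc i))
      shifted : shift w (mulPoly w n a f) k ≡ A
      shifted = trans (shift-sum w n _ k) (sum-cong n (λ i _ →
                  trans (shift-* w (a i) _ k) (cong (a i *_) (shift-shift w (i ℕ.* w) f k))))
      S : ℤ
      S = sum n (λ i → a i * X i)
      dropLast : sum (suc n) (λ i → a i * X i) ≡ S
      dropLast = begin
        sum (suc n) (λ i → a i * X i) ≡⟨ sum-last n _ ⟩
        S + a n * X n                 ≡⟨ cong (λ z → S + z * X n) aₙ≡0 ⟩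
        S + 0ℤ * X n                  ≡⟨ cong (_+_ S) (ℤ.*-zeroˡ (X n)) ⟩
        S + 0ℤ                        ≡⟨ ℤ.+-identityʳ S ⟩
        S                             ∎
      regroup : ∀ A c a₀ x₀ B → A + c * (a₀ * x₀ + B) ≡ (0ℤ + c * a₀) * x₀ + (A + c * B)
      regroup = solve-∀
      expand : ∀ a c a′ x → a * x + c * (a′ * x) ≡ (a + c * a′) * x
      expand = solve-∀
      collect : A + c * B ≡ sum n (λ i → (a i + c * a (suc i)) * X (suc i))
      collect = begin
        A + c * B ≡⟨ cong (_+_ A) (*-distribˡ-sum n c _) ⟩
        A + sum n (λ i → c * (a (suc i) * X (suc i))) ≡⟨ sym (sum-distrib-+ n _ _) ⟩
        sum n (λ i → a i * X (suc i) + c * (a (suc i) * X (suc i)))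
          ≡⟨ sum-cong n (λ i _ → expand (a i) c (a (suc i)) (X (suc i))) ⟩
        sum n (λ i → (a i + c * a (suc i)) * X (suc i)) ∎

  mulFactors-mulPoly : ∀ w cs n f k → mulFactors w cs n f k ≡ mulPoly w (suc n) (productCoeffs cs n) f k
  mulFactors-mulPoly w cs zero    f k = x≡1*x+0 (f k)
    where
      x≡1*x+0 : ∀ x → x ≡ 1ℤ * x + 0ℤ
      x≡1*x+0 = solve-∀
  mulFactors-mulPoly w cs (suc n) f k = begin
    mulFactor w (cs n) (mulFactors w cs n f) k
      ≡⟨ mulFactor-cong w (cs n) (mulFactors-mulPoly w cs n f) k ⟩
    mulFactor w (cs n) (mulPoly w (suc n) (productCoeffs cs n) f) k
      ≡⟨ mulFactor-mulPoly w (cs n) (suc n) (productCoeffs cs n) f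
                           (productCoeffs-degree cs n (ℕ.n<1+n n)) k ⟩
    mulPoly w (suc (suc n)) (productCoeffs cs (suc n)) f k ∎

  mulFactors-+ : ∀ w cs d e f k → mulFactors w cs (d ℕ.+ e) f k ≡
                 mulFactors w (λ j → cs (d ℕ.+ j)) e (mulFactors w cs d f) k
  mulFactors-+ w cs d zero    f k = cong (λ n → mulFactors w cs n f k) (ℕ.+-identityʳ d)
  mulFactors-+ w cs d (suc e) f k = begin
    mulFactors w cs (d ℕ.+ suc e) f k
      ≡⟨ cong (λ n → mulFactors w cs n f k) (ℕ.+-suc d e) ⟩
    mulFactor w (cs (d ℕ.+ e)) (mulFactors w cs (d ℕ.+ e) f) k
      ≡⟨ mulFactor-cong w (cs (d ℕ.+ e)) (mulFactors-+ w cs d e f) k ⟩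
    mulFactors w (λ j → cs (d ℕ.+ j)) (suc e) (mulFactors w cs d f) k ∎

  shift-mulFactor : ∀ e w c f k → mulFactor w c (shift e f) k ≡ shift e (mulFactor w c f) k
  shift-mulFactor e w c f k = begin
    shift w (shift e f) k + c * shift e f k
      ≡⟨ cong (_+ c * shift e f k) shifts-commute ⟩
    shift e (shift w f) k + c * shift e f k
      ≡⟨ trans (shift-+ e (shift w f) _ k) (cong (_+_ (shift e (shift w f) k)) (shift-* e c f k)) ⟨
    shift e (mulFactor w c f) k ∎
    where
      shifts-commute : shift w (shift e f) k ≡ shift e (shift w f) k
      shifts-commute = begin
        shift w (shift e f) k ≡⟨ shift-shift w e f k ⟩
        shift (w ℕ.+ e) f k   ≡⟨ cong (λ d → shift d f k) (ℕ.+-comm w e) ⟩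
        shift (e ℕ.+ w) f k   ≡⟨ sym (shift-shift e w f k) ⟩
        shift e (shift w f) k ∎

  mulShiftedFactor : ℕ → ℕ → ℤ → Series → Series
  mulShiftedFactor v w c f = shift v (mulFactor w c f)

  fold-mulShiftedFactor : ∀ v w c n f k → fold f (mulShiftedFactor v w c) n k ≡
                          shift (n ℕ.* v) (mulFactors w (const c) n f) k
  fold-mulShiftedFactor v w c zero    f k = refl
  fold-mulShiftedFactor v w c (suc n) f k = begin
    shift v (mulFactor w c (fold f (mulShiftedFactor v w c) n)) k
      ≡⟨ shift-cong v (mulFactor-cong w c (fold-mulShiftedFactor v w c n f)) k ⟩
    shift v (mulFactor w c (shift (n ℕ.* v) M)) k
      ≡⟨ shift-cong v (shift-mulFactor (n ℕ.* v) w c M) k ⟩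
    shift v (shift (n ℕ.* v) (mulFactor w c M)) k
      ≡⟨ shift-shift v (n ℕ.* v) _ k ⟩
    shift (suc n ℕ.* v) (mulFactor w c M) k ∎
    where
      M : Series
      M = mulFactors w (const c) n f

  mulPoly-binomial : ∀ w n {a b} c f k → a < n → b < n →
                     mulPoly w n (λ i → monomial a i + c * monomial b i) f k ≡
                     shift (a ℕ.* w) f k + c * shift (b ℕ.* w) f k
  mulPoly-binomial w n c f k = sum-select₂ n c (λ i → shift (i ℕ.* w) f k)

  shift-mulPoly-monomial : ∀ e w n a k → shift e (mulPoly w n a (monomial 0)) k ≡
                           sum n (λ i → a i * monomial (e ℕ.+ i ℕ.* w) k)
  shift-mulPoly-monomial e w n a k = trans (shift-sum e n _ k) (sum-cong n (λ i _ → begin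
    shift e (λ k → a i * shift (i ℕ.* w) (monomial 0) k) k ≡⟨ shift-* e (a i) _ k ⟩
    a i * shift e (shift (i ℕ.* w) (monomial 0)) k
      ≡⟨ cong (a i *_) (trans (shift-shift e (i ℕ.* w) _ k) (shift-monomial (e ℕ.+ i ℕ.* w) k)) ⟩
    a i * monomial (e ℕ.+ i ℕ.* w) k ∎))

  binomialCoeffs : ℤ → ℕ → Series
  binomialCoeffs c = productCoeffs (const c)

  binomialCoeffs-absorb : ∀ c n i →
                          + suc i * binomialCoeffs c (suc n) (suc i) ≡ + suc n * binomialCoeffs c n i
  binomialCoeffs-absorb c zero    zero    = cong (λ z → 1ℤ * (1ℤ + z)) (ℤ.*-zeroʳ c)
  binomialCoeffs-absorb c zero    (suc i) =
    trans (cong (λ z → + suc (suc i) * (0ℤ + z)) (ℤ.*-zeroʳ c)) (ℤ.*-zeroʳ (+ suc (suc i)))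
  binomialCoeffs-absorb c (suc n) zero    = begin
    1ℤ * (β (suc n) 0 + c * β (suc n) 1)
      ≡⟨ regroup (β (suc n) 0) c (β (suc n) 1) ⟩
    β (suc n) 0 + c * (1ℤ * β (suc n) 1)
      ≡⟨ cong (λ z → β (suc n) 0 + c * z) (binomialCoeffs-absorb c n 0) ⟩
    β (suc n) 0 + c * (+ suc n * β n 0)
      ≡⟨ collect c (β n 0) (+ n) ⟩
    + suc (suc n) * β (suc n) 0 ∎
    where
      β = binomialCoeffs c
      regroup : ∀ x c y → 1ℤ * (x + c * y) ≡ x + c * (1ℤ * y)
      regroup = solve-∀
      collect : ∀ c b n → (0ℤ + c * b) + c * ((1ℤ + n) * b) ≡ (1ℤ + (1ℤ + n)) * (0ℤ + c * b)
      collect = solve-∀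
  binomialCoeffs-absorb c (suc n) (suc i) = begin
    + suc (suc i) * (β (suc n) (suc i) + c * β (suc n) (suc (suc i)))
      ≡⟨ regroup (+ suc i) (β (suc n) (suc i)) c _ ⟩
    β (suc n) (suc i) + + suc i * β (suc n) (suc i) + c * (+ suc (suc i) * β (suc n) (suc (suc i)))
      ≡⟨ cong₂ (λ u v → β (suc n) (suc i) + u + c * v)
               (binomialCoeffs-absorb c n i) (binomialCoeffs-absorb c n (suc i)) ⟩
    β (suc n) (suc i) + + suc n * β n i + c * (+ suc n * β n (suc i))
      ≡⟨ collect (+ suc n) (β n i) c (β n (suc i)) ⟩
    + suc (suc n) * β (suc n) (suc i) ∎
    where
      β = binomialCoeffs c
      regroup : ∀ i x c y → (1ℤ + i) * (x + c * y) ≡ x + i * x + c * ((1ℤ + i) * y)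
      regroup = solve-∀
      collect : ∀ n a c b → (a + c * b) + n * a + c * (n * b) ≡ (1ℤ + n) * (a + c * b)
      collect = solve-∀

  binomialCoeffs-zero : ∀ c n → binomialCoeffs c n 0 ≡ c ^ n
  binomialCoeffs-zero c zero    = refl
  binomialCoeffs-zero c (suc n) =
    trans (ℤ.+-identityˡ _) (cong (c *_) (binomialCoeffs-zero c n))

  binomialCoeffs-one-subdiag : ∀ j → binomialCoeffs 1ℤ (suc j) j ≡ + suc j
  binomialCoeffs-one-subdiag zero    = refl
  binomialCoeffs-one-subdiag (suc j) = begin
    binomialCoeffs 1ℤ (suc j) j + 1ℤ * binomialCoeffs 1ℤ (suc j) (suc j)
      ≡⟨ cong₂ (λ u v → u + 1ℤ * v) (binomialCoeffs-one-subdiag j)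
                                     (productCoeffs-top (const 1ℤ) (suc j)) ⟩
    + suc j + 1ℤ * 1ℤ
      ≡⟨ cong +_ (ℕ.+-comm (suc j) 1) ⟩
    + suc (suc j) ∎

  rising : ℕ → Series → Series
  rising = mulFactors 1 (λ j → + j)

  risingCoeffs : ℕ → Series
  risingCoeffs n = rising n (monomial 0)

  risingFact≡risingCoeffs : ∀ n k → + risingFact n k ≡ risingCoeffs n k
  risingFact≡risingCoeffs zero    zero    = refl
  risingFact≡risingCoeffs zero    (suc k) = refl
  risingFact≡risingCoeffs (suc n) zero    = begin
    + (n ℕ.* risingFact n 0)      ≡⟨ ℤ.pos-* n _ ⟩
    + n * + risingFact n 0        ≡⟨ cong (+ n *_) (risingFact≡risingCoeffs n 0) ⟩
    + n * risingCoeffs n 0        ≡⟨ ℤ.+-identityˡ _ ⟨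
    0ℤ + + n * risingCoeffs n 0   ∎
  risingFact≡risingCoeffs (suc n) (suc k) = begin
    + (risingFact n k ℕ.+ n ℕ.* risingFact n (suc k))
      ≡⟨ trans (ℤ.pos-+ (risingFact n k) _) (cong (_+_ (+ risingFact n k)) (ℤ.pos-* n _)) ⟩
    + risingFact n k + + n * + risingFact n (suc k)
      ≡⟨ cong₂ (λ u v → u + + n * v) (risingFact≡risingCoeffs n k)
                                      (risingFact≡risingCoeffs n (suc k)) ⟩
    risingCoeffs n k + + n * risingCoeffs n (suc k) ∎

  risingCoeffs-zero : ∀ n → risingCoeffs (suc n) 0 ≡ 0ℤ
  risingCoeffs-zero zero    = refl
  risingCoeffs-zero (suc n) = begin
    0ℤ + + suc n * risingCoeffs (suc n) 0 ≡⟨ ℤ.+-identityˡ _ ⟩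
    + suc n * risingCoeffs (suc n) 0      ≡⟨ cong (+ suc n *_) (risingCoeffs-zero n) ⟩
    + suc n * 0ℤ                          ≡⟨ ℤ.*-zeroʳ (+ suc n) ⟩
    0ℤ                                    ∎

  -- g(x + 1), for g of degree below n.
  translate : ℕ → Series → Series
  translate n g j = sum n (λ k → g k * binomialCoeffs 1ℤ k j)

  translate-linear : ∀ n (f g : Series) c j →
                     translate n (λ k → f k + c * g k) j ≡ translate n f j + c * translate n g j
  translate-linear n f g c j = begin
    sum n (λ k → (f k + c * g k) * C k)
      ≡⟨ sum-cong n (λ k _ → expand (f k) c (g k) (C k)) ⟩
    sum n (λ k → f k * C k + c * (g k * C k))
      ≡⟨ sum-distrib-+ n _ _ ⟩
    translate n f j + sum n (λ k → c * (g k * C k))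
      ≡⟨ cong (_+_ (translate n f j)) (*-distribˡ-sum n c _) ⟨
    translate n f j + c * translate n g j ∎
    where
      C : ℕ → ℤ
      C k = binomialCoeffs 1ℤ k j
      expand : ∀ x c y z → (x + c * y) * z ≡ x * z + c * (y * z)
      expand = solve-∀

  translate-shift : ∀ n (g : Series) j →
                    translate (suc n) (shift 1 g) j ≡ mulFactor 1 1ℤ (translate n g) j
  translate-shift n g j = begin
    0ℤ * C 0 j + sum n T
      ≡⟨ trans (cong (λ z → z + sum n T) (ℤ.*-zeroˡ (C 0 j))) (ℤ.+-identityˡ _) ⟩
    sum n T
      ≡⟨ sum-cong n (λ k _ → expand (g k) (shift 1 (C k) j) (C k j)) ⟩
    sum n (λ k → g k * shift 1 (C k) j + 1ℤ * (g k * C k j))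
      ≡⟨ sum-distrib-+ n _ _ ⟩
    sum n (λ k → g k * shift 1 (C k) j) + sum n (λ k → 1ℤ * (g k * C k j))
      ≡⟨ cong₂ _+_ (sym (trans (shift-sum 1 n _ j) (sum-cong n (λ k _ → shift-* 1 (g k) (C k) j))))
                   (sym (*-distribˡ-sum n 1ℤ _)) ⟩
    shift 1 (translate n g) j + 1ℤ * translate n g j ∎
    where
      C : ℕ → ℕ → ℤ
      C = binomialCoeffs 1ℤ
      T : ℕ → ℤ
      T k = g k * (shift 1 (C k) j + 1ℤ * C k j)
      expand : ∀ g s c → g * (s + 1ℤ * c) ≡ g * s + 1ℤ * (g * c)
      expand = solve-∀

  -- x(x+1)⋯(x+n) = x · R(x + 1) with R = x(x+1)⋯(x+n-1).
  translate-rising : ∀ n B → n < B →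
                     ∀ j → translate B (risingCoeffs n) j ≡ risingCoeffs (suc n) (suc j)
  translate-rising zero    (suc B) _ j = begin
    1ℤ * C 0 j + sum B (λ k → 0ℤ * C (suc k) j)
      ≡⟨ cong (_+_ (1ℤ * C 0 j)) (sum-zero B (λ k _ → ℤ.*-zeroˡ (C (suc k) j))) ⟩
    1ℤ * C 0 j + 0ℤ
      ≡⟨ simplify (C 0 j) (monomial 0 (suc j)) ⟩
    C 0 j + 0ℤ * monomial 0 (suc j) ∎
    where
      C : ℕ → ℕ → ℤ
      C = binomialCoeffs 1ℤ
      simplify : ∀ x y → 1ℤ * x + 0ℤ ≡ x + 0ℤ * y
      simplify = solve-∀
  translate-rising (suc n) (suc B) (s≤s n<B) j = begin
    translate (suc B) (risingCoeffs (suc n)) j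
      ≡⟨ translate-linear (suc B) (shift 1 (risingCoeffs n)) (risingCoeffs n) (+ n) j ⟩
    translate (suc B) (shift 1 (risingCoeffs n)) j + + n * translate (suc B) (risingCoeffs n) j
      ≡⟨ cong₂ (λ u v → u + + n * v) (translate-shift B (risingCoeffs n) j)
                                      (translate-rising n (suc B) (ℕ.m<n⇒m<1+n n<B) j) ⟩
    shift 1 (translate B (risingCoeffs n)) j + 1ℤ * translate B (risingCoeffs n) j + + n * r (suc j)
      ≡⟨ cong₂ (λ u v → u + 1ℤ * v + + n * r (suc j))
               (shift-cong 1 (translate-rising n B n<B) j) (translate-rising n B n<B j) ⟩
    shift 1 (λ j → r (suc j)) j + 1ℤ * r (suc j) + + n * r (suc j)
      ≡⟨ cong (λ u → u + 1ℤ * r (suc j) + + n * r (suc j)) (unshift j) ⟩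
    r j + 1ℤ * r (suc j) + + n * r (suc j)
      ≡⟨ collect (r j) (r (suc j)) (+ n) ⟩
    r j + + suc n * r (suc j) ∎
    where
      r : Series
      r = risingCoeffs (suc n)
      unshift : ∀ j → shift 1 (λ j → r (suc j)) j ≡ r j
      unshift zero    = sym (risingCoeffs-zero n)
      unshift (suc j) = refl
      collect : ∀ a b n → a + 1ℤ * b + n * b ≡ a + (1ℤ + n) * b
      collect = solve-∀


module SeriesModulo (m : ℤ) where
  open import Data.Integer.Base using (_+_; _*_)
  import Data.Integer.Properties as ℤ
  open Congruence m
  open Series

  infix 4 _≋_
  _≋_ : Series → Series → Set
  f ≋ g = ∀ k → f k ≈ g k

  sum-≈ : ∀ n {f g : ℕ → ℤ} → (∀ i → i < n → f i ≈ g i) → sum n f ≈ sum n g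
  sum-≈ zero    f≈g = ≈-refl
  sum-≈ (suc n) f≈g = +-cong (f≈g 0 (s≤s z≤n)) (sum-≈ n (λ i i<n → f≈g (suc i) (s≤s i<n)))

  sum-support₂ : ∀ n {a b} (h : ℕ → ℤ) → a < n → b < n → a ≢ b →
                 (∀ k → k < n → k ≢ a → k ≢ b → h k ≈ 0ℤ) → sum n h ≈ h a + h b
  sum-support₂ n {a} {b} h a<n b<n a≢b outside = begin
    sum n h                                              ≈⟨ sum-≈ n (λ k k<n → termwise k k<n) ⟩
    sum n (λ k → (monomial a k + 1ℤ * monomial b k) * h k) ≡⟨ sum-select₂ n 1ℤ h a<n b<n ⟩
    h a + 1ℤ * h b                                       ≡⟨ cong (_+_ (h a)) (ℤ.*-identityˡ (h b)) ⟩
    h a + h b                                            ∎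
    where
      open ≈-Reasoning
      termwise : ∀ k → k < n → h k ≈ (monomial a k + 1ℤ * monomial b k) * h k
      termwise k k<n with k ℕ.≟ a | k ℕ.≟ b
      ... | yes refl | _        rewrite monomial-diag k | monomial-≢ (a≢b ∘ sym) =
        ≈-reflexive (sym (ℤ.*-identityˡ (h k)))
      ... | no k≢a   | yes refl rewrite monomial-diag k | monomial-≢ (k≢a ∘ sym) =
        ≈-reflexive (sym (ℤ.*-identityˡ (h k)))
      ... | no k≢a   | no k≢b   rewrite monomial-≢ (k≢a ∘ sym) | monomial-≢ (k≢b ∘ sym) =
        ≈-trans (outside k k<n k≢a k≢b) (≈-reflexive (sym (ℤ.*-zeroˡ (h k))))

  shift-≈ : ∀ e {f g} → f ≋ g → shift e f ≋ shift e g
  shift-≈ zero    f≈g k       = f≈g k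
  shift-≈ (suc e) f≈g zero    = ≈-refl
  shift-≈ (suc e) f≈g (suc k) = shift-≈ e f≈g k

  mulFactor-≈ : ∀ w {c d f g} → c ≈ d → f ≋ g → mulFactor w c f ≋ mulFactor w d g
  mulFactor-≈ w c≈d f≈g k = +-cong (shift-≈ w f≈g k) (*-cong c≈d (f≈g k))

  mulFactors-≈ : ∀ w {cs ds} n {f g} → (∀ j → cs j ≈ ds j) → f ≋ g →
                 mulFactors w cs n f ≋ mulFactors w ds n g
  mulFactors-≈ w zero    cs≈ds f≈g = f≈g
  mulFactors-≈ w (suc n) cs≈ds f≈g = mulFactor-≈ w (cs≈ds n) (mulFactors-≈ w n cs≈ds f≈g)

  mulPoly-≈ : ∀ w n {a b} f → (∀ i → i < n → a i ≈ b i) → mulPoly w n a f ≋ mulPoly w n b f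
  mulPoly-≈ w n f a≈b k = sum-≈ n (λ i i<n → *-cong (a≈b i i<n) ≈-refl)

  fold-≈ : ∀ {F G : Series → Series} → (∀ {f g} → f ≋ g → F f ≋ G g) →
           ∀ n {f g} → f ≋ g → fold f F n ≋ fold g G n
  fold-≈ F≈G zero    f≈g = f≈g
  fold-≈ F≈G (suc n) f≈g = F≈G (fold-≈ F≈G n f≈g)

  rising-periodic : ∀ c → + c ≈ 0ℤ → ∀ j f → rising (c ℕ.* j) f ≋ fold f (rising c) j
  rising-periodic c c≈0 zero    f k = ≈-reflexive (cong (λ n → rising n f k) (ℕ.*-zeroʳ c))
  rising-periodic c c≈0 (suc j) f k = begin
    rising (c ℕ.* suc j) f k
      ≡⟨ cong (λ n → rising n f k) (trans (ℕ.*-suc c j) (ℕ.+-comm c (c ℕ.* j))) ⟩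
    rising (c ℕ.* j ℕ.+ c) f k
      ≡⟨ mulFactors-+ 1 (λ i → + i) (c ℕ.* j) c f k ⟩
    mulFactors 1 (λ i → + (c ℕ.* j ℕ.+ i)) c (rising (c ℕ.* j) f) k
      ≈⟨ mulFactors-≈ 1 c offset≈ (rising-periodic c c≈0 j f) k ⟩
    rising c (fold f (rising c) j) k ∎
    where
      open ≈-Reasoning
      cj≈0 : + (c ℕ.* j) ≈ 0ℤ
      cj≈0 = begin
        + (c ℕ.* j) ≡⟨ ℤ.pos-* c j ⟩
        + c * + j   ≈⟨ *-cong c≈0 ≈-refl ⟩
        0ℤ * + j    ≡⟨ ℤ.*-zeroˡ (+ j) ⟩
        0ℤ          ∎
      offset≈ : ∀ i → + (c ℕ.* j ℕ.+ i) ≈ + i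
      offset≈ i = begin
        + (c ℕ.* j ℕ.+ i) ≡⟨ ℤ.pos-+ (c ℕ.* j) i ⟩
        + (c ℕ.* j) + + i ≈⟨ +-cong cj≈0 (≈-refl {+ i}) ⟩
        0ℤ + + i          ≡⟨ ℤ.+-identityˡ (+ i) ⟩
        + i               ∎

  translate-near-top : ∀ n (g : Series) j → suc j < n → (∀ k → suc j < k → g k ≈ 0ℤ) →
                   translate n g j ≈ g j + + suc j * g (suc j)
  translate-near-top n g j sj<n g≈0 = begin
    translate n g j
      ≈⟨ sum-support₂ n h (ℕ.<-trans (ℕ.n<1+n j) sj<n) sj<n (ℕ.1+n≢n ∘ sym) outside ⟩
    g j * C j j + g (suc j) * C (suc j) j
      ≡⟨ cong₂ (λ u v → g j * u + g (suc j) * v) (productCoeffs-top (const 1ℤ) j)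
                                                  (binomialCoeffs-one-subdiag j) ⟩
    g j * 1ℤ + g (suc j) * + suc j
      ≡⟨ cong₂ _+_ (ℤ.*-identityʳ (g j)) (ℤ.*-comm (g (suc j)) (+ suc j)) ⟩
    g j + + suc j * g (suc j) ∎
    where
      open ≈-Reasoning
      C : ℕ → ℕ → ℤ
      C = binomialCoeffs 1ℤ
      h : ℕ → ℤ
      h k = g k * C k j
      outside : ∀ k → k < n → k ≢ j → k ≢ suc j → h k ≈ 0ℤ
      outside k _ k≢j k≢1+j with ℕ.<-cmp k j
      ... | tri< k<j _ _ =
        ≈-reflexive (trans (cong (g k *_) (productCoeffs-degree (const 1ℤ) k k<j)) (ℤ.*-zeroʳ (g k)))
      ... | tri≈ _ k≡j _ = ⊥-elim (k≢j k≡j)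
      ... | tri> _ _ j<k = begin
        g k * C k j ≈⟨ *-cong (g≈0 k (ℕ.≤∧≢⇒< j<k (k≢1+j ∘ sym))) ≈-refl ⟩
        0ℤ * C k j  ≡⟨ ℤ.*-zeroˡ (C k j) ⟩
        0ℤ          ∎

module ModuloPrime (q : ℕ) (prime : Prime (suc q)) where
  open import Data.Integer.Base using (_+_; _*_; _^_)
  import Data.Integer.Properties as ℤ
  open import Data.Integer.Tactic.RingSolver using (solve-∀)
  import Data.Integer.Divisibility.Signed as ℤ
  open import Data.Nat.Divisibility using (divides; ∣⇒≤) renaming (_∣_ to _∣ℕ_)
  open Series

  p : ℕ
  p = suc q

  open Congruence (+ p) public
  open SeriesModulo (+ p) public
  open ≈-Reasoning

  1<p : 1 < p
  1<p = ℕ.nonTrivial⇒n>1 p {{prime⇒nonTrivial prime}}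

  ≈0⇒p∣∣x∣ : ∀ {x} → x ≈ 0ℤ → p ∣ℕ ∣ x ∣
  ≈0⇒p∣∣x∣ {x} (r by x≡0+r*p) =
    divides ∣ r ∣ (trans (cong ∣_∣ (trans x≡0+r*p (ℤ.+-identityˡ (r * + p)))) (ℤ.abs-* r (+ p)))

  p∣∣x∣⇒≈0 : ∀ {x} → p ∣ℕ ∣ x ∣ → x ≈ 0ℤ
  p∣∣x∣⇒≈0 p∣∣x∣ with ℤ.∣ᵤ⇒∣ p∣∣x∣
  ... | ℤ.divides r x≡r*p = r by trans x≡r*p (sym (ℤ.+-identityˡ _))

  j*x≈0⇒x≈0 : ∀ {j} x → 0 < j → j < p → + j * x ≈ 0ℤ → x ≈ 0ℤ
  j*x≈0⇒x≈0 {suc j} x _ j<p jx≈0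
    with euclidsLemma (suc j) ∣ x ∣ prime
                      (subst (p ∣ℕ_) (ℤ.abs-* (+ suc j) x) (≈0⇒p∣∣x∣ jx≈0))
  ... | inj₁ p∣j = ⊥-elim (ℕ.<⇒≱ j<p (∣⇒≤ p∣j))
  ... | inj₂ p∣x = p∣∣x∣⇒≈0 p∣x

  binomialCoeffs-inner≈0 : ∀ c {i} → 0 < i → i < p → binomialCoeffs c p i ≈ 0ℤ
  binomialCoeffs-inner≈0 c {suc i} 0<i i<p = j*x≈0⇒x≈0 _ 0<i i<p (begin
    + suc i * binomialCoeffs c p (suc i) ≡⟨ binomialCoeffs-absorb c q i ⟩
    + p * binomialCoeffs c q i           ≈⟨ m*x≈0 _ ⟩
    0ℤ                                   ∎)

  binomialCoeffs-prime-pos : ∀ c i → binomialCoeffs c p (suc i) ≈ monomial p (suc i)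
  binomialCoeffs-prime-pos c i with ℕ.<-cmp (suc i) p
  ... | tri< i<p _ _  =
    ≈-trans (binomialCoeffs-inner≈0 c (s≤s z≤n) i<p)
            (≈-reflexive (sym (monomial-≢ (ℕ.>⇒≢ i<p))))
  ... | tri≈ _ refl _ =
    ≈-reflexive (trans (productCoeffs-top (const c) p) (sym (monomial-diag p)))
  ... | tri> _ _ p<i  =
    ≈-reflexive (trans (productCoeffs-degree (const c) p p<i) (sym (monomial-≢ (ℕ.<⇒≢ p<i))))

  binomialCoeffs-prime : ∀ c i → binomialCoeffs c p i ≈ monomial p i + c ^ p * monomial 0 i
  binomialCoeffs-prime c zero    = begin
    binomialCoeffs c p 0 ≡⟨ binomialCoeffs-zero c p ⟩
    c ^ p                ≡⟨ ℤ.*-identityʳ (c ^ p) ⟨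
    c ^ p * 1ℤ           ≡⟨ ℤ.+-identityˡ (c ^ p * 1ℤ) ⟨
    0ℤ + c ^ p * 1ℤ      ∎
  binomialCoeffs-prime c (suc i) = begin
    binomialCoeffs c p (suc i)      ≈⟨ binomialCoeffs-prime-pos c i ⟩
    monomial p (suc i)              ≡⟨ ℤ.+-identityʳ (monomial p (suc i)) ⟨
    monomial p (suc i) + 0ℤ         ≡⟨ cong (_+_ (monomial p (suc i))) (ℤ.*-zeroʳ (c ^ p)) ⟨
    monomial p (suc i) + c ^ p * 0ℤ ∎

  binomialCoeffs-pred-prime : ∀ {i} → i ≤ q → binomialCoeffs -1ℤ q i ≈ 1ℤ
  binomialCoeffs-pred-prime i≤q =
    ≈-trans (≈-stepwise β q step i≤q) (≈-reflexive (productCoeffs-top (const -1ℤ) q))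
    where
      β : Series
      β = binomialCoeffs -1ℤ q
      sub-add : ∀ x y → x ≡ (x + -1ℤ * y) + y
      sub-add = solve-∀
      step : ∀ i → i < q → β i ≈ β (suc i)
      step i i<q = begin
        β i
          ≡⟨ sub-add (β i) (β (suc i)) ⟩
        (β i + -1ℤ * β (suc i)) + β (suc i)
          ≈⟨ +-cong (binomialCoeffs-inner≈0 -1ℤ z<s (s≤s i<q)) ≈-refl ⟩
        0ℤ + β (suc i)
          ≡⟨ ℤ.+-identityˡ (β (suc i)) ⟩
        β (suc i) ∎

  -1^p≈-1 : -1ℤ ^ p ≈ -1ℤ
  -1^p≈-1 = *-congˡ -1ℤ (≈-trans (≈-reflexive (sym (binomialCoeffs-zero -1ℤ q)))
                                 (binomialCoeffs-pred-prime z≤n))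

  frobenius : ∀ c w f → mulFactors w (const c) p f ≋ mulFactor (p ℕ.* w) (c ^ p) f
  frobenius c w f k = begin
    mulFactors w (const c) p f k
      ≡⟨ mulFactors-mulPoly w (const c) p f k ⟩
    mulPoly w (suc p) (binomialCoeffs c p) f k
      ≈⟨ mulPoly-≈ w (suc p) f (λ i _ → binomialCoeffs-prime c i) k ⟩
    mulPoly w (suc p) (λ i → monomial p i + c ^ p * monomial 0 i) f k
      ≡⟨ mulPoly-binomial w (suc p) (c ^ p) f k (ℕ.n<1+n p) (s≤s z≤n) ⟩
    shift (p ℕ.* w) f k + c ^ p * f k ∎

  xᵖ-x : Series
  xᵖ-x k = monomial p k + -1ℤ * monomial 1 k

  translate-xᵖ-x : ∀ j → translate (suc p) xᵖ-x j ≈ xᵖ-x j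
  translate-xᵖ-x j = begin
    translate (suc p) xᵖ-x j
      ≡⟨ sum-select₂ (suc p) -1ℤ (λ k → C k j) (ℕ.n<1+n p) (s≤s (s≤s z≤n)) ⟩
    C p j + -1ℤ * C 1 j
      ≈⟨ +-cong (binomialCoeffs-prime 1ℤ j) ≈-refl ⟩
    (monomial p j + 1ℤ ^ p * monomial 0 j) + -1ℤ * (shift 1 (monomial 0) j + 1ℤ * monomial 0 j)
      ≡⟨ cong₂ (λ u v → (monomial p j + u * monomial 0 j) + -1ℤ * (v + 1ℤ * monomial 0 j))
               (ℤ.^-zeroˡ p) (shift-monomial 1 j) ⟩
    (monomial p j + 1ℤ * monomial 0 j) + -1ℤ * (monomial 1 j + 1ℤ * monomial 0 j)
      ≡⟨ cancel (monomial p j) (monomial 0 j) (monomial 1 j) ⟩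
    xᵖ-x j ∎
    where
      C : ℕ → ℕ → ℤ
      C = binomialCoeffs 1ℤ
      cancel : ∀ a b c → (a + 1ℤ * b) + -1ℤ * (c + 1ℤ * b) ≡ a + -1ℤ * c
      cancel = solve-∀

  translation-invariant⇒constant : ∀ n (g : Series) → p ≤ n → (∀ k → p ≤ k → g k ≈ 0ℤ) →
                                   (∀ j → translate n g j ≈ g j) → ∀ k → 0 < k → g k ≈ 0ℤ
  translation-invariant⇒constant n g p≤n high invariant k = downward p k (ℕ.m≤n+m p k)
    where
      downward : ∀ d k → p ≤ k ℕ.+ d → 0 < k → g k ≈ 0ℤ
      downward zero    k       p≤k+0 _ = high k (subst (p ≤_) (ℕ.+-identityʳ k) p≤k+0)
      downward (suc d) (suc j) p≤j+2+d _ with p ℕ.≤? suc j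
      ... | yes p≤k = high (suc j) p≤k
      ... | no  p≰k = j*x≈0⇒x≈0 (g (suc j)) (s≤s z≤n) k<p (+-cancelˡ (g j) (begin
        g j + + suc j * g (suc j) ≈⟨ translate-near-top n g j (ℕ.<-≤-trans k<p p≤n) above ⟨
        translate n g j           ≈⟨ invariant j ⟩
        g j                       ≡⟨ ℤ.+-identityʳ (g j) ⟨
        g j + 0ℤ                  ∎))
        where
          k<p : suc j < p
          k<p = ℕ.≰⇒> p≰k
          above : ∀ k → suc j < k → g k ≈ 0ℤ
          above k 1+j<k = downward d k p≤k+d (ℕ.≤-trans z<s 1+j<k)
            where
              p≤k+d : p ≤ k ℕ.+ d
              p≤k+d = ℕ.≤-trans p≤j+2+d
                        (ℕ.≤-trans (ℕ.≤-reflexive (ℕ.+-suc (suc j) d)) (ℕ.+-monoˡ-≤ d 1+j<k))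

  risingCoeffs-prime : ∀ k → risingCoeffs p k ≈ xᵖ-x k
  risingCoeffs-prime zero    = ≈-reflexive (risingCoeffs-zero q)
  risingCoeffs-prime (suc k) = begin
    r (suc k)                       ≡⟨ sub-add (r (suc k)) (xᵖ-x (suc k)) ⟩
    D (suc k) + xᵖ-x (suc k)        ≈⟨ +-cong (D≈0 (suc k) (s≤s z≤n)) ≈-refl ⟩
    0ℤ + xᵖ-x (suc k)               ≡⟨ ℤ.+-identityˡ (xᵖ-x (suc k)) ⟩
    xᵖ-x (suc k)                    ∎
    where
      r : Series
      r = risingCoeffs p
      D : Series
      D k = r k + -1ℤ * xᵖ-x k
      sub-add : ∀ x y → x ≡ (x + -1ℤ * y) + y
      sub-add = solve-∀
      D-at : ∀ k {a b c} → r k ≡ a → monomial p k ≡ b → monomial 1 k ≡ c →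
             D k ≡ a + -1ℤ * (b + -1ℤ * c)
      D-at k r≡a xᵖ≡b x≡c =
        cong₂ (λ u v → u + -1ℤ * v) r≡a (cong₂ (λ u v → u + -1ℤ * v) xᵖ≡b x≡c)
      high : ∀ k → p ≤ k → D k ≈ 0ℤ
      high k p≤k with ℕ.m≤n⇒m<n∨m≡n p≤k
      ... | inj₂ refl =
        ≈-reflexive (D-at p (productCoeffs-top _ p) (monomial-diag p) (monomial-≢ (ℕ.<⇒≢ 1<p)))
      ... | inj₁ p<k  = ≈-reflexive (D-at k (productCoeffs-degree _ p p<k) (monomial-≢ (ℕ.<⇒≢ p<k))
                                            (monomial-≢ (ℕ.<⇒≢ (ℕ.<-trans 1<p p<k))))
      invariant : ∀ j → translate (suc p) D j ≈ D j
      invariant j = begin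
        translate (suc p) D j
          ≡⟨ translate-linear (suc p) r xᵖ-x -1ℤ j ⟩
        translate (suc p) r j + -1ℤ * translate (suc p) xᵖ-x j
          ≡⟨ cong (λ u → u + -1ℤ * translate (suc p) xᵖ-x j)
                  (translate-rising p (suc p) (ℕ.n<1+n p) j) ⟩
        (r j + + p * r (suc j)) + -1ℤ * translate (suc p) xᵖ-x j
          ≈⟨ +-cong (+-cong (≈-refl {r j}) (m*x≈0 (r (suc j))))
                    (*-congˡ -1ℤ (translate-xᵖ-x j)) ⟩
        (r j + 0ℤ) + -1ℤ * xᵖ-x j
          ≡⟨ cong (λ u → u + -1ℤ * xᵖ-x j) (ℤ.+-identityʳ (r j)) ⟩
        D j ∎
      D≈0 : ∀ k → 0 < k → D k ≈ 0ℤ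
      D≈0 = translation-invariant⇒constant (suc p) D (ℕ.n≤1+n p) high invariant

  rising-prime : ∀ f → rising p f ≋ mulShiftedFactor 1 q -1ℤ f
  rising-prime f k = begin
    rising p f k
      ≡⟨ mulFactors-mulPoly 1 (λ j → + j) p f k ⟩
    mulPoly 1 (suc p) (risingCoeffs p) f k
      ≈⟨ mulPoly-≈ 1 (suc p) f (λ i _ → risingCoeffs-prime i) k ⟩
    mulPoly 1 (suc p) xᵖ-x f k
      ≡⟨ mulPoly-binomial 1 (suc p) -1ℤ f k (ℕ.n<1+n p) (s≤s (s≤s z≤n)) ⟩
    shift (p ℕ.* 1) f k + -1ℤ * shift 1 f k
      ≡⟨ cong (λ e → shift e f k + -1ℤ * shift 1 f k) (ℕ.*-identityʳ p) ⟩
    shift p f k + -1ℤ * shift 1 f k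
      ≡⟨ trans (shift-+ 1 (shift q f) _ k) (cong₂ _+_ (shift-shift 1 q f k) (shift-* 1 -1ℤ f k)) ⟨
    shift 1 (mulFactor q -1ℤ f) k ∎

  p^[1+a]≈0 : ∀ a → + (p ℕ.^ suc a) ≈ 0ℤ
  p^[1+a]≈0 a = ≈-trans (≈-reflexive (ℤ.pos-* p (p ℕ.^ a))) (m*x≈0 (+ (p ℕ.^ a)))

  rising-prime-power : ∀ a {f g} → f ≋ g →
                       rising (p ℕ.^ suc a) f ≋ mulShiftedFactor (p ℕ.^ a) (p ℕ.^ a ℕ.* q) -1ℤ g
  rising-prime-power zero {f} {g} f≈g k = begin
    rising (p ℕ.* 1) f k
      ≡⟨ cong (λ n → rising n f k) (ℕ.*-identityʳ p) ⟩
    rising p f k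
      ≈⟨ mulFactors-≈ 1 p (λ _ → ≈-refl) f≈g k ⟩
    rising p g k
      ≈⟨ rising-prime g k ⟩
    mulShiftedFactor 1 q -1ℤ g k
      ≡⟨ cong (λ w → mulShiftedFactor 1 w -1ℤ g k) (ℕ.*-identityˡ q) ⟨
    mulShiftedFactor 1 (1 ℕ.* q) -1ℤ g k ∎
  rising-prime-power (suc a) {f} {g} f≈g k = begin
    rising (p ℕ.* c) f k
      ≡⟨ cong (λ n → rising n f k) (ℕ.*-comm p c) ⟩
    rising (c ℕ.* p) f k
      ≈⟨ rising-periodic c (p^[1+a]≈0 a) p f k ⟩
    fold f (rising c) p k
      ≈⟨ fold-≈ (rising-prime-power a) p f≈g k ⟩
    fold g (mulShiftedFactor v w -1ℤ) p k
      ≡⟨ fold-mulShiftedFactor v w -1ℤ p g k ⟩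
    shift (p ℕ.* v) (mulFactors w (const -1ℤ) p g) k
      ≈⟨ shift-≈ (p ℕ.* v) (λ k → ≈-trans (frobenius -1ℤ w g k)
                                           (mulFactor-≈ (p ℕ.* w) -1^p≈-1 (λ _ → ≈-refl) k)) k ⟩
    shift (p ℕ.* v) (mulFactor (p ℕ.* w) -1ℤ g) k
      ≡⟨ cong (λ w → shift (p ℕ.* v) (mulFactor w -1ℤ g) k) (ℕ.*-assoc p v q) ⟨
    mulShiftedFactor (p ℕ.* v) (p ℕ.* v ℕ.* q) -1ℤ g k ∎
    where
      c v w : ℕ
      c = p ℕ.^ suc a
      v = p ℕ.^ a
      w = v ℕ.* q

  stirling1-p^α[p-1] : ∀ a k → + stirling1 (p ℕ.^ suc a ℕ.* q) k ≈
                               sum p (λ i → monomial (suc i ℕ.* (p ℕ.^ a ℕ.* q)) k)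
  stirling1-p^α[p-1] a k = begin
    + stirling1 (c ℕ.* q) k
      ≡⟨ risingFact≡risingCoeffs (c ℕ.* q) k ⟩
    rising (c ℕ.* q) (monomial 0) k
      ≈⟨ rising-periodic c (p^[1+a]≈0 a) q (monomial 0) k ⟩
    fold (monomial 0) (rising c) q k
      ≈⟨ fold-≈ (rising-prime-power a) q (λ _ → ≈-refl) k ⟩
    fold (monomial 0) (mulShiftedFactor v w -1ℤ) q k
      ≡⟨ fold-mulShiftedFactor v w -1ℤ q (monomial 0) k ⟩
    shift (q ℕ.* v) (mulFactors w (const -1ℤ) q (monomial 0)) k
      ≡⟨ shift-cong (q ℕ.* v) (mulFactors-mulPoly w (const -1ℤ) q (monomial 0)) k ⟩
    shift (q ℕ.* v) (mulPoly w p (binomialCoeffs -1ℤ q) (monomial 0)) k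
      ≈⟨ shift-≈ (q ℕ.* v) (mulPoly-≈ w p (monomial 0) (λ _ → binomialCoeffs-pred-prime ∘ ℕ.s≤s⁻¹))
                 k ⟩
    shift (q ℕ.* v) (mulPoly w p (const 1ℤ) (monomial 0)) k
      ≡⟨ shift-mulPoly-monomial (q ℕ.* v) w p (const 1ℤ) k ⟩
    sum p (λ i → 1ℤ * monomial (q ℕ.* v ℕ.+ i ℕ.* w) k)
      ≡⟨ sum-cong p (λ i _ → trans (ℤ.*-identityˡ _)
                                   (cong (λ e → monomial (e ℕ.+ i ℕ.* w) k) (ℕ.*-comm q v))) ⟩
    sum p (λ i → monomial (suc i ℕ.* w) k) ∎
    where
      c v w : ℕ
      c = p ℕ.^ suc a
      v = p ℕ.^ a
      w = v ℕ.* q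

open Series using (sum; monomial; sum-monomial-injective; sum-monomial-miss)
open Congruence using (_by_)

≈⇒≡[mod] : ∀ {n} a b → Congruence._≈_ (+ n) (+ a) (+ b) → a ≡ b [mod n ]
≈⇒≡[mod] {n} a b (+ t by eq) = 0 , t , cong ∣_∣ (begin
  + (a ℕ.+ 0 ℕ.* n)       ≡⟨ cong +_ (ℕ.+-identityʳ a) ⟩
  + a                     ≡⟨ eq ⟩
  + b + + t * + n         ≡⟨ cong (_+_ (+ b)) (ℤ.pos-* t n) ⟨
  + b + + (t ℕ.* n)       ≡⟨ ℤ.pos-+ b (t ℕ.* n) ⟨
  + (b ℕ.+ t ℕ.* n)       ∎)
  where
    open import Data.Integer.Base using (_+_; _*_)
    import Data.Integer.Properties as ℤ
    open ≡-Reasoning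
≈⇒≡[mod] {n} a b (-[1+ t ] by eq) = suc t , 0 , cong ∣_∣ (begin
  + (a ℕ.+ suc t ℕ.* n)
    ≡⟨ trans (ℤ.pos-+ a _) (cong (_+_ (+ a)) (ℤ.pos-* (suc t) n)) ⟩
  + a + + suc t * + n
    ≡⟨ cong (_+ + suc t * + n) eq ⟩
  (+ b + -[1+ t ] * + n) + + suc t * + n
    ≡⟨ cancel (+ b) -[1+ t ] (+ n) ⟩
  + b
    ≡⟨ cong +_ (ℕ.+-identityʳ b) ⟨
  + (b ℕ.+ 0 ℕ.* n) ∎)
  where
    open import Data.Integer.Base using (_+_; _*_; -_)
    import Data.Integer.Properties as ℤ
    open import Data.Integer.Tactic.RingSolver using (solve-∀)
    open ≡-Reasoning
    cancel : ∀ b r n → (b + r * n) + (- r) * n ≡ b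
    cancel = solve-∀

-- Opened only now: in the modules above, _*_ and _^_ are the integer operations.
open import Data.Nat.Base using (_*_; _∸_; _^_; NonZero)

multiple-in-range : ∀ {m n k} .{{_ : NonZero m}} → 1 ≤ k → k ≤ n * m → k ≡ 0 [mod m ] →
                    ∃[ i ] i < n × suc i * m ≡ k
multiple-in-range {m} {n} {k} 1≤k k≤n*m (x , y , k+x*m≡y*m) = from-quotient (y ∸ x) k≡[y∸x]*m
  where
    open ≡-Reasoning
    k≡[y∸x]*m : k ≡ (y ∸ x) * m
    k≡[y∸x]*m = begin
      k                   ≡⟨ ℕ.m+n∸n≡m k (x * m) ⟨
      k ℕ.+ x * m ∸ x * m ≡⟨ cong (_∸ x * m) k+x*m≡y*m ⟩
      y * m ∸ x * m       ≡⟨ ℕ.*-distribʳ-∸ m y x ⟨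
      (y ∸ x) * m         ∎
    from-quotient : ∀ d → k ≡ d * m → ∃[ i ] i < n × suc i * m ≡ k
    from-quotient zero    k≡0         = ⊥-elim (ℕ.<⇒≢ 1≤k (sym k≡0))
    from-quotient (suc i) k≡[1+i]*m =
      i , ℕ.*-cancelʳ-≤ (suc i) n m (subst (_≤ n * m) k≡[1+i]*m k≤n*m) , sym k≡[1+i]*m

lemma4p1 : (p α k : ℕ) → Prime p → 1 ≤ α → 1 ≤ k → k ≤ p ^ α * (p ∸ 1) →
    (k ≡ 0 [mod p ^ (α ∸ 1) * (p ∸ 1) ] → stirling1 (p ^ α * (p ∸ 1)) k ≡ 1 [mod p ])
    × (¬ (k ≡ 0 [mod p ^ (α ∸ 1) * (p ∸ 1) ]) → stirling1 (p ^ α * (p ∸ 1)) k ≡ 0 [mod p ])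
lemma4p1 zero            _       _ p-prime = ⊥-elim (¬prime[0] p-prime)
lemma4p1 (suc zero)      _       _ p-prime = ⊥-elim (¬prime[1] p-prime)
lemma4p1 (suc (suc _))   zero    _ _       ()
lemma4p1 (suc q@(suc _)) (suc a) k p-prime _ 1≤k k≤n = divisible , indivisible
  where
    open ModuloPrime q p-prime using (p; _≈_; ≈-trans; ≈-reflexive; stirling1-p^α[p-1])
    m : ℕ
    m = p ^ a * q
    instance
      m≢0 : NonZero m
      m≢0 = ℕ.m*n≢0 (p ^ a) q {{ℕ.m^n≢0 p a}}
    coefficient : + stirling1 (p ^ suc a * q) k ≈ sum p (λ i → monomial (suc i * m) k)
    coefficient = stirling1-p^α[p-1] a k
    divisible : k ≡ 0 [mod m ] → stirling1 (p ^ suc a * q) k ≡ 1 [mod p ]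
    divisible k≡0 with multiple-in-range 1≤k (subst (k ≤_) (ℕ.*-assoc p (p ^ a) q) k≤n) k≡0
    ... | i , i<p , [1+i]*m≡k = ≈⇒≡[mod] _ 1 (≈-trans coefficient (≈-reflexive
          (sum-monomial-injective p (λ i → suc i * m) (ℕ.suc-injective ∘ ℕ.*-cancelʳ-≡ _ _ m)
                                  i<p [1+i]*m≡k)))
    indivisible : ¬ (k ≡ 0 [mod m ]) → stirling1 (p ^ suc a * q) k ≡ 0 [mod p ]
    indivisible k≢0 = ≈⇒≡[mod] _ 0 (≈-trans coefficient (≈-reflexive
      (sum-monomial-miss p (λ i → suc i * m) (λ i _ [1+i]*m≡k →
        k≢0 (0 , suc i , trans (ℕ.+-identityʳ k) (sym [1+i]*m≡k))))))
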